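{- For $n \geq 6$ let $e(n)$ (respectively $o(n)$) be the number of partitions of $n$ with parts $p_1 \geq p_2 \geq \cdots \geq p_k$ such that (a) $k \geq 3$; (b) $p_1 = p_2 = p_3 \geq 3$ and this common value is even (respectively odd); (c) the remaining parts $p_4,\dots,p_k$ (if any) are pairwise distinct; (d) if $k \geq 4$ then $p_4 \leq p_3 - 2$; (e) the smallest part is not $1$. Then for every $n \geq 6$: (i) $e(n) = o(n)$ whenever $n$ is not of any of the forms $\tfrac12(3t^2+t+4)$, $\tfrac12(3(t+1)^2-t-1)$, $\tfrac12(3(t+1)^2-t+3)$, $\tfrac12(3(t+1)^2+t+1)$ with $t$ an integer $\geq 2$; (ii) $e(n) = o(n) - 1$ whenever $n = \tfrac12(3t^2+t+4)$ or $n = \tfrac12(3(t+1)^2+t+1)$ for some integer $t \geq 2$; (iii) $e(n) = o(n) + 1$ whenever $n = \tfrac12(3(t+1)^2-t-1)$ or $n = \tfrac12(3(t+1)^2-t+3)$ for some integer $t \geq 2$. -}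

module Defs where

open import Data.Nat using (ℕ; zero; suc; _+_; _*_; _≤_; _<_)
open import Data.Nat.Divisibility using (_∣_)
open import Data.List using (List; []; _∷_; length; last)
open import Data.Nat.ListAction using (sum)
open import Data.List.Relation.Unary.All using (All)
open import Data.List.Relation.Unary.AllPairs using (AllPairs)
open import Data.List.Relation.Unary.Linked using (Linked)
open import Data.List.Relation.Unary.Unique.Propositional using (Unique)
open import Data.List.Membership.Propositional using (_∈_)
open import Data.Maybe using (Maybe; just)
open import Data.Product using (Σ; _×_)
open import Data.Sum using (_⊎_)
open import Data.Empty using (⊥)
open import Data.Unit using (⊤)
open import Function.Bundles using (_⇔_)
open import Relation.Binary.PropositionalEquality using (_≡_; _≢_)
open import Relation.Nullary using (¬_)

IsPartition : ℕ → List ℕ → Set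
IsPartition n ps = Linked (λ a b → b ≤ a) ps × All (λ p → 1 ≤ p) ps × sum ps ≡ n

FourthCond : ℕ → List ℕ → Set
FourthCond p3 []        = ⊤
FourthCond p3 (p4 ∷ _)  = p4 + 2 ≤ p3

Shape : (ℕ → Set) → List ℕ → Set
Shape par []                        = ⊥
Shape par (_ ∷ [])                  = ⊥
Shape par (_ ∷ _ ∷ [])              = ⊥
Shape par ps@(p1 ∷ p2 ∷ p3 ∷ rest)  =
  p1 ≡ p2 × p2 ≡ p3 × 3 ≤ p3 × par p3
  × AllPairs _≢_ rest
  × FourthCond p3 rest
  × last ps ≢ just 1

Even Odd : ℕ → Set
Even m = 2 ∣ m
Odd m = ¬ (2 ∣ m)

EPart OPart : ℕ → List ℕ → Set
EPart n ps = IsPartition n ps × Shape Even ps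
OPart n ps = IsPartition n ps × Shape Odd ps

HasCount : (List ℕ → Set) → ℕ → Set
HasCount P m = Σ (List (List ℕ)) λ L → Unique L × (∀ ps → (ps ∈ L) ⇔ P ps) × length L ≡ m

-- The four forms, for an integer t ≥ 2 (all equations multiplied by 2, moved to ℕ).
FormA FormB FormC FormD : ℕ → Set
-- n = (3t² + t + 4)/2
FormA n = Σ ℕ λ t → 2 ≤ t × 2 * n ≡ 3 * (t * t) + t + 4
-- n = (3(t+1)² - t - 1)/2
FormB n = Σ ℕ λ t → 2 ≤ t × 2 * n + t + 1 ≡ 3 * ((t + 1) * (t + 1))
-- n = (3(t+1)² - t + 3)/2
FormC n = Σ ℕ λ t → 2 ≤ t × 2 * n + t ≡ 3 * ((t + 1) * (t + 1)) + 3
-- n = (3(t+1)² + t + 1)/2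
FormD n = Σ ℕ λ t → 2 ≤ t × 2 * n ≡ 3 * ((t + 1) * (t + 1)) + t + 1

{-# OPTIONS --safe #-}
module Submission where

-- Write the common value p₁ = p₂ = p₃ as 3 + i. Conditions (c)–(e) say exactly that the
-- remaining parts form a set of distinct integers in [2, i + 1] with sum n − 9 − 3i, and the
-- parity of 3 + i alternates with i, so
--   o(n) − e(n) = Σᵢ (−1)ⁱ T₂(i, n − 9 − 3i),
-- where T_c(L, z) counts the subsets of {c, …, c + L − 1} with sum z. Deciding whether the
-- least element c belongs to such a subset turns the alternating sums
--   ρ_c(z) = Σⱼ (−1)ʲ T_c(j + 1, z − cj)
-- into the recursion ρ_c(z) = δ(z) − δ(z − 2c − 1) + ρ_{c+1}(z − 3c − 2), a finite analogue of
-- Euler's pentagonal number theorem: ρ_c is +1 on one quadratic sequence of points, −1 on an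
-- interleaved one, and 0 elsewhere, and for c ≥ 2 no two of these points are 2 apart. The same
-- splitting gives o(n) − e(n) = ρ₂(n − 9) + ρ₂(n − 7) − δ(n − 7). Shifted by 9 and by 7, the
-- +1 points of ρ₂ are the forms (3t² + t + 4)/2 and (3(t+1)² + t + 1)/2 (apart from n = 7,
-- where δ cancels), and the −1 points are the forms (3(t+1)² − t + 3)/2 and (3(t+1)² − t − 1)/2.

open import Algebra.Properties.CommutativeSemigroup using (interchange)
open import Data.Bool using (Bool; true; false; not)
open import Data.Bool.Properties using (not-¬; ¬-not)
open import Data.Empty using (⊥-elim)
open import Data.Integer as ℤ using (ℤ; +_; -[1+_]; 0ℤ; _◃_)
import Data.Integer.Properties as ℤₚ
open import Data.Integer.Tactic.RingSolver using (solve-∀)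
open import Data.List using (List; []; _∷_; _++_; map; length; last)
open import Data.List.Properties using (length-++; length-map; ∷-injectiveʳ; ∷-injectiveˡ)
open import Data.List.Membership.Propositional using (_∈_)
open import Data.List.Membership.Propositional.Properties using (∈-++⁻; ∈-++⁺ˡ; ∈-++⁺ʳ; ∈-map⁺; ∈-map⁻)
open import Data.List.Relation.Unary.All as All using (All; []; _∷_)
open import Data.List.Relation.Unary.AllPairs as AllPairs using ([]; _∷_)
open import Data.List.Relation.Unary.Any using (here)
open import Data.List.Relation.Unary.Linked as Linked using (Linked; []; [-]; _∷_)
open import Data.List.Relation.Unary.Linked.Properties using (Linked⇒All; Linked⇒AllPairs; AllPairs⇒Linked)
open import Data.List.Relation.Unary.Unique.Propositional using (Unique)
import Data.List.Relation.Unary.Unique.Propositional.Properties as Unique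
open import Data.Maybe using (just)
open import Data.Nat using (ℕ; zero; suc; _+_; _*_; _≤_; _<_; _≥_; _>_; z≤n; s≤s; _≟_)
open import Data.Nat.Divisibility using (_∣_; divides; ∣1⇒≡1; ∣m+n∣m⇒∣n; n∣m*n)
open import Data.Nat.ListAction using (sum)
open import Data.Nat.Properties
open import Data.Nat.Tactic.RingSolver using () renaming (solve-∀ to solve-∀ℕ)
open import Data.Product using (Σ; _×_; _,_; proj₁; proj₂)
open import Data.Sign as Sign using (Sign)
open import Data.Sum using (_⊎_; inj₁; inj₂)
open import Data.Unit using (⊤; tt)
open import Function.Bundles using (_⇔_; mk⇔; Equivalence)
open import Relation.Binary.Definitions using (Transitive)
open import Relation.Binary.PropositionalEquality
open import Relation.Nullary using (¬_; yes; no)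

open import Defs

-- Integer targets

-- Targets are integers so that removing a part never truncates; every count vanishes below 0.
infixl 6 _-ₙ_

_-ₙ_ : ℤ → ℕ → ℤ
z -ₙ d = z ℤ.- + d

-ₙ-+ : ∀ z a b → z -ₙ a -ₙ b ≡ z -ₙ (a + b)
-ₙ-+ z a b = trans (lemma z (+ a) (+ b)) (cong (λ x → z ℤ.- x) (sym (ℤₚ.pos-+ a b)))
  where
  lemma : ∀ (z x y : ℤ) → z ℤ.- x ℤ.- y ≡ z ℤ.- (x ℤ.+ y)
  lemma = solve-∀

-ₙ-merge : ∀ z a b {c} → a + b ≡ c → z -ₙ a -ₙ b ≡ z -ₙ c
-ₙ-merge z a b a+b≡c = trans (-ₙ-+ z a b) (cong (z -ₙ_) a+b≡c)

-ₙ-comm : ∀ z a b → z -ₙ a -ₙ b ≡ z -ₙ b -ₙ a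
-ₙ-comm z a b = lemma z (+ a) (+ b)
  where
  lemma : ∀ (z x y : ℤ) → z ℤ.- x ℤ.- y ≡ z ℤ.- y ℤ.- x
  lemma = solve-∀

m+n-ₙm≡n : ∀ m n → + (m + n) -ₙ m ≡ + n
m+n-ₙm≡n m n = trans (cong (ℤ._- + m) (ℤₚ.pos-+ m n)) (lemma (+ m) (+ n))
  where
  lemma : ∀ (x y : ℤ) → x ℤ.+ y ℤ.- x ≡ y
  lemma = solve-∀

-[1+]-ₙ : ∀ n d → Σ ℕ λ k → -[1+ n ] -ₙ d ≡ -[1+ k ]
-[1+]-ₙ n zero    = n , refl
-[1+]-ₙ n (suc d) = suc (n + d) , refl

-ₙ-view : ∀ w a → (Σ ℕ λ k → w ≡ a + k) ⊎ (Σ ℕ λ k → + w -ₙ a ≡ -[1+ k ])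
-ₙ-view w       zero    = inj₁ (w , refl)
-ₙ-view zero    (suc a) = inj₂ (a , refl)
-ₙ-view (suc w) (suc a) with -ₙ-view w a
... | inj₁ (k , w≡a+k) = inj₁ (k , cong suc w≡a+k)
... | inj₂ (k , eq)    = inj₂ (k , trans (+suc-ₙsuc w a) eq)
  where
  +suc-ₙsuc : ∀ w a → + suc w -ₙ suc a ≡ + w -ₙ a
  +suc-ₙsuc w a = trans (ℤₚ.m-n≡m⊖n (suc w) (suc a))
    (trans (ℤₚ.[1+m]⊖[1+n]≡m⊖n w a) (sym (ℤₚ.m-n≡m⊖n w a)))

n-ₙa≡w⇒n≡a+w : ∀ {n a w} → + n -ₙ a ≡ + w → n ≡ a + w
n-ₙa≡w⇒n≡a+w {n} {a} eq with -ₙ-view n a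
... | inj₁ (k , refl) = cong (_+_ a) (ℤₚ.+-injective (trans (sym (m+n-ₙm≡n a k)) eq))
... | inj₂ (k , n-a<0) with () ← trans (sym n-a<0) eq

s≡z-ₙx⇒x+s≡z : ∀ x s z → + s ≡ z -ₙ x → + (x + s) ≡ z
s≡z-ₙx⇒x+s≡z x s z eq = trans (ℤₚ.pos-+ x s) (trans (cong (ℤ._+_ (+ x)) eq) (lemma (+ x) z))
  where
  lemma : ∀ (x z : ℤ) → x ℤ.+ (z ℤ.- x) ≡ z
  lemma = solve-∀

x+s≡z⇒s≡z-ₙx : ∀ x s z → + (x + s) ≡ z → + s ≡ z -ₙ x
x+s≡z⇒s≡z-ₙx x s z refl = sym (m+n-ₙm≡n x s)

-- Alternating sums of subset counts

δ : ℤ → ℕ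
δ (+ zero) = 1
δ _        = 0

δ-≢ : ∀ {w a} → w ≢ a → δ (+ w -ₙ a) ≡ 0
δ-≢ {w} {a} w≢a with -ₙ-view w a
... | inj₂ (k , eq) rewrite eq = refl
... | inj₁ (zero , w≡a+0) = ⊥-elim (w≢a (trans w≡a+0 (+-identityʳ a)))
... | inj₁ (suc k , refl) rewrite m+n-ₙm≡n a (suc k) = refl

δ-nonzero : ∀ {w} → w ≢ 0 → δ (+ w) ≡ 0
δ-nonzero {zero}  w≢0 = ⊥-elim (w≢0 refl)
δ-nonzero {suc _} _   = refl

δ-self : ∀ w → δ (+ w -ₙ w) ≡ 1
δ-self w = cong δ (ℤₚ.+-inverseʳ (+ w))

subsetCount : ℕ → ℕ → ℤ → ℕ
subsetCount c zero    z = δ z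
subsetCount c (suc L) z = subsetCount c L z + subsetCount c L (z -ₙ (c + L))

subsetCount-neg : ∀ c L n → subsetCount c L -[1+ n ] ≡ 0
subsetCount-neg c zero    n = refl
subsetCount-neg c (suc L) n with -[1+]-ₙ n (c + L)
... | k , eq rewrite eq | subsetCount-neg c L n | subsetCount-neg c L k = refl

-- the least element c is either absent or present
subsetCount-split : ∀ c L z →
  subsetCount c (suc L) z ≡ subsetCount (suc c) L z + subsetCount (suc c) L (z -ₙ c)
subsetCount-split c zero z rewrite +-identityʳ c = refl
subsetCount-split c (suc L) z = begin
  T c (suc L) z + T c (suc L) (z -ₙ (c + suc L))
    ≡⟨ cong₂ _+_ (subsetCount-split c L z) (subsetCount-split c L (z -ₙ (c + suc L))) ⟩
  (A z + A (z -ₙ c)) + (A (z -ₙ (c + suc L)) + A (z -ₙ (c + suc L) -ₙ c))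
    ≡⟨ cong (λ x → (A z + A (z -ₙ c)) + (A (z -ₙ x) + A (z -ₙ x -ₙ c))) (+-suc c L) ⟩
  (A z + A (z -ₙ c)) + (A (z -ₙ (suc c + L)) + A (z -ₙ (suc c + L) -ₙ c))
    ≡⟨ cong (λ x → (A z + A (z -ₙ c)) + (A (z -ₙ (suc c + L)) + A x)) (-ₙ-comm z (suc c + L) c) ⟩
  (A z + A (z -ₙ c)) + (A (z -ₙ (suc c + L)) + A (z -ₙ c -ₙ (suc c + L)))
    ≡⟨ interchange +-commutativeSemigroup (A z) _ _ _ ⟩
  T (suc c) (suc L) z + T (suc c) (suc L) (z -ₙ c) ∎
  where
  open ≡-Reasoning
  T = subsetCount
  A = subsetCount (suc c) L

-- altSum k c d L z = Σ_{j<k} (-1)^j · subsetCount c (L + j) (z - d j)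
altSum : ℕ → ℕ → ℕ → ℕ → ℤ → ℤ
altSum zero    c d L z = 0ℤ
altSum (suc k) c d L z = + subsetCount c L z ℤ.- altSum k c d (suc L) (z -ₙ d)

Exceeds : ℕ → ℤ → Set
Exceeds k (+ w)     = w < k
Exceeds k -[1+ _ ]  = ⊤

fuel : ℤ → ℕ
fuel (+ w)    = suc w
fuel -[1+ _ ] = 0

-- For d ≥ 1 the terms with j > z vanish, so any k exceeding z gives the complete sum.
alt : ℕ → ℕ → ℕ → ℤ → ℤ
alt c d L z = altSum (fuel z) c d L z

Exceeds-fuel : ∀ z → Exceeds (fuel z) z
Exceeds-fuel (+ w)     = ≤-refl
Exceeds-fuel -[1+ _ ]  = tt

Exceeds-shift : ∀ {d} → 1 ≤ d → ∀ k z → Exceeds (suc k) z → Exceeds k (z -ₙ d)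
Exceeds-shift {d} _ k -[1+ n ] _ with -[1+]-ₙ n d
... | _ , eq rewrite eq = tt
Exceeds-shift {d} 1≤d k (+ w) (s≤s w≤k) with -ₙ-view w d
... | inj₂ (_ , eq) rewrite eq = tt
... | inj₁ (m , refl) rewrite m+n-ₙm≡n d m = ≤-trans (+-monoˡ-≤ m 1≤d) w≤k

Exceeds-sub : ∀ n a → Exceeds (suc n) (+ n -ₙ a)
Exceeds-sub n a with -ₙ-view n a
... | inj₁ (k , refl) rewrite m+n-ₙm≡n a k = s≤s (m≤n+m k a)
... | inj₂ (k , eq) rewrite eq = tt

altSum-neg : ∀ k c d L n → altSum k c d L -[1+ n ] ≡ 0ℤ
altSum-neg zero    c d L n = refl
altSum-neg (suc k) c d L n with -[1+]-ₙ n d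
... | m , eq rewrite eq | subsetCount-neg c L n | altSum-neg k c d (suc L) m = refl

altSum-fuel-irrelevant : ∀ {c d} → 1 ≤ d → ∀ k k' L z → Exceeds k z → Exceeds k' z →
  altSum k c d L z ≡ altSum k' c d L z
altSum-fuel-irrelevant _ zero k' L -[1+ n ] _ _ = sym (altSum-neg k' _ _ L n)
altSum-fuel-irrelevant _ (suc k) zero L -[1+ n ] _ _ = altSum-neg (suc k) _ _ L n
altSum-fuel-irrelevant {d = d} 1≤d (suc k) (suc k') L z ex ex' =
  cong (λ x → + subsetCount _ L z ℤ.- x)
    (altSum-fuel-irrelevant 1≤d k k' (suc L) (z -ₙ d)
      (Exceeds-shift 1≤d k z ex) (Exceeds-shift 1≤d k' z ex'))

alt-unfold : ∀ {c d} → 1 ≤ d → ∀ L z →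
  alt c d L z ≡ + subsetCount c L z ℤ.- alt c d (suc L) (z -ₙ d)
alt-unfold {c} {d} 1≤d L (+ w) = cong (λ x → + subsetCount c L (+ w) ℤ.- x)
  (altSum-fuel-irrelevant 1≤d w (fuel (+ w -ₙ d)) (suc L) (+ w -ₙ d)
    (Exceeds-shift 1≤d w (+ w) ≤-refl) (Exceeds-fuel _))
alt-unfold {c} {d} _ L -[1+ n ] with -[1+]-ₙ n d
... | _ , eq rewrite eq | subsetCount-neg c L n = refl

alt-split : ∀ c {d} → 1 ≤ d → ∀ L y →
  alt c d (suc L) y ≡ alt (suc c) d L y ℤ.+ alt (suc c) d L (y -ₙ c)
alt-split c {d} 1≤d L y = go (fuel y) y (Exceeds-fuel y) L
  where
  go : ∀ k y → Exceeds k y → ∀ L → alt c d (suc L) y ≡ alt (suc c) d L y ℤ.+ alt (suc c) d L (y -ₙ c)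
  go k -[1+ n ] _ L with -[1+]-ₙ n c
  ... | _ , eq rewrite eq = refl
  go (suc k) y@(+ _) ex L = begin
    alt c d (suc L) y
      ≡⟨ alt-unfold 1≤d (suc L) y ⟩
    + subsetCount c (suc L) y ℤ.- alt c d (suc (suc L)) (y -ₙ d)
      ≡⟨ cong₂ (λ x u → + x ℤ.- u) (subsetCount-split c L y)
           (go k (y -ₙ d) (Exceeds-shift 1≤d k y ex) (suc L)) ⟩
    + (T y + T (y -ₙ c)) ℤ.- (A (suc L) (y -ₙ d) ℤ.+ A (suc L) (y -ₙ d -ₙ c))
      ≡⟨ cong (λ x → + (T y + T (y -ₙ c)) ℤ.- (A (suc L) (y -ₙ d) ℤ.+ A (suc L) x)) (-ₙ-comm y d c) ⟩
    + (T y + T (y -ₙ c)) ℤ.- (A (suc L) (y -ₙ d) ℤ.+ A (suc L) (y -ₙ c -ₙ d))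
      ≡⟨ regroup (T y) (T (y -ₙ c)) (A (suc L) (y -ₙ d)) (A (suc L) (y -ₙ c -ₙ d)) ⟩
    (+ T y ℤ.- A (suc L) (y -ₙ d)) ℤ.+ (+ T (y -ₙ c) ℤ.- A (suc L) (y -ₙ c -ₙ d))
      ≡⟨ sym (cong₂ ℤ._+_ (alt-unfold 1≤d L y) (alt-unfold 1≤d L (y -ₙ c))) ⟩
    A L y ℤ.+ A L (y -ₙ c) ∎
    where
    open ≡-Reasoning
    T = subsetCount (suc c) L
    A = alt (suc c) d
    regroup : ∀ a b (p q : ℤ) → + (a + b) ℤ.- (p ℤ.+ q) ≡ (+ a ℤ.- p) ℤ.+ (+ b ℤ.- q)
    regroup a b p q rewrite ℤₚ.pos-+ a b = lemma (+ a) (+ b) p q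
      where
      lemma : ∀ (a b p q : ℤ) → a ℤ.+ b ℤ.- (p ℤ.+ q) ≡ (a ℤ.- p) ℤ.+ (b ℤ.- q)
      lemma = solve-∀

alt-diagonal-step : ∀ {c} → 1 ≤ c → ∀ L z →
  alt c c (suc L) z ≡ + subsetCount (suc c) L z ℤ.- alt (suc c) (suc c) L (z -ₙ (c + c + suc L))
alt-diagonal-step {c} 1≤c L z = go (fuel z) z (Exceeds-fuel z) L
  where
  go : ∀ k z → Exceeds k z → ∀ L →
    alt c c (suc L) z ≡ + subsetCount (suc c) L z ℤ.- alt (suc c) (suc c) L (z -ₙ (c + c + suc L))
  go k -[1+ n ] _ L with -[1+]-ₙ n (c + c + suc L)
  ... | _ , eq rewrite eq | subsetCount-neg (suc c) L n = refl
  go (suc k) z@(+ _) ex L = begin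
    alt c c (suc L) z
      ≡⟨ alt-unfold 1≤c (suc L) z ⟩
    + subsetCount c (suc L) z ℤ.- alt c c (suc (suc L)) (z -ₙ c)
      ≡⟨ cong₂ (λ x y → + x ℤ.- y) (subsetCount-split c L z)
           (go k (z -ₙ c) (Exceeds-shift 1≤c k z ex) (suc L)) ⟩
    + (T z + T (z -ₙ c)) ℤ.- (+ (T (z -ₙ c) + T (z -ₙ c -ₙ (suc c + L))) ℤ.- A (suc L) (z -ₙ c -ₙ (c + c + suc (suc L))))
      ≡⟨ cancel (T z) (T (z -ₙ c)) (T (z -ₙ c -ₙ (suc c + L))) (A (suc L) (z -ₙ c -ₙ (c + c + suc (suc L)))) ⟩
    + T z ℤ.- (+ T (z -ₙ c -ₙ (suc c + L)) ℤ.- A (suc L) (z -ₙ c -ₙ (c + c + suc (suc L))))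
      ≡⟨ cong₂ (λ x y → + T z ℤ.- (+ T x ℤ.- A (suc L) y))
           (-ₙ-merge z c (suc c + L) (offset₁ c L))
           (trans (-ₙ-merge z c (c + c + suc (suc L)) (offset₂ c L)) (sym (-ₙ-+ z (c + c + suc L) (suc c)))) ⟩
    + T z ℤ.- (+ T z' ℤ.- A (suc L) (z' -ₙ suc c))
      ≡⟨ cong (λ x → + T z ℤ.- x) (sym (alt-unfold (s≤s z≤n) L z')) ⟩
    + T z ℤ.- A L z' ∎
    where
    open ≡-Reasoning
    T = subsetCount (suc c) L
    A = alt (suc c) (suc c)
    z' = z -ₙ (c + c + suc L)
    offset₁ : ∀ c L → c + (suc c + L) ≡ c + c + suc L
    offset₁ = solve-∀ℕ
    offset₂ : ∀ c L → c + (c + c + suc (suc L)) ≡ c + c + suc L + suc c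
    offset₂ = solve-∀ℕ
    cancel : ∀ a b e (v : ℤ) → + (a + b) ℤ.- (+ (b + e) ℤ.- v) ≡ + a ℤ.- (+ e ℤ.- v)
    cancel a b e v rewrite ℤₚ.pos-+ a b | ℤₚ.pos-+ b e = lemma (+ a) (+ b) (+ e) v
      where
      lemma : ∀ (a b e v : ℤ) → a ℤ.+ b ℤ.- (b ℤ.+ e ℤ.- v) ≡ a ℤ.- (e ℤ.- v)
      lemma = solve-∀

ρ : ℕ → ℤ → ℤ
ρ c z = alt c c 1 z

stride : ℕ → ℕ
stride c = 2 + 3 * c

ρ-step : ∀ {c} → 1 ≤ c → ∀ z →
  ρ c z ≡ + δ z ℤ.- + δ (z -ₙ (1 + 2 * c)) ℤ.+ ρ (suc c) (z -ₙ stride c)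
ρ-step {c} 1≤c z = begin
  ρ c z
    ≡⟨ alt-unfold 1≤c 1 z ⟩
  + (δ z + δ (z -ₙ (c + 0))) ℤ.- alt c c 2 (z -ₙ c)
    ≡⟨ cong₂ (λ x y → + (δ z + δ (z -ₙ x)) ℤ.- y) (+-identityʳ c)
         (alt-diagonal-step 1≤c 1 (z -ₙ c)) ⟩
  + (δ z + δ (z -ₙ c)) ℤ.- (+ (δ (z -ₙ c) + δ (z -ₙ c -ₙ (suc c + 0))) ℤ.- ρ (suc c) (z -ₙ c -ₙ (c + c + 2)))
    ≡⟨ cancel (δ z) (δ (z -ₙ c)) (δ (z -ₙ c -ₙ (suc c + 0))) (ρ (suc c) (z -ₙ c -ₙ (c + c + 2))) ⟩
  + δ z ℤ.- + δ (z -ₙ c -ₙ (suc c + 0)) ℤ.+ ρ (suc c) (z -ₙ c -ₙ (c + c + 2))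
    ≡⟨ cong₂ (λ x y → + δ z ℤ.- + δ x ℤ.+ ρ (suc c) y)
         (-ₙ-merge z c (suc c + 0) (offset₁ c)) (-ₙ-merge z c (c + c + 2) (offset₂ c)) ⟩
  + δ z ℤ.- + δ (z -ₙ (1 + 2 * c)) ℤ.+ ρ (suc c) (z -ₙ stride c) ∎
  where
  open ≡-Reasoning
  offset₁ : ∀ c → c + (suc c + 0) ≡ 1 + 2 * c
  offset₁ = solve-∀ℕ
  offset₂ : ∀ c → c + (c + c + 2) ≡ 2 + 3 * c
  offset₂ = solve-∀ℕ
  cancel : ∀ a b e (v : ℤ) → + (a + b) ℤ.- (+ (b + e) ℤ.- v) ≡ + a ℤ.- + e ℤ.+ v
  cancel a b e v rewrite ℤₚ.pos-+ a b | ℤₚ.pos-+ b e = lemma (+ a) (+ b) (+ e) v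
    where
    lemma : ∀ (a b e v : ℤ) → a ℤ.+ b ℤ.- (b ℤ.+ e ℤ.- v) ≡ a ℤ.- e ℤ.+ v
    lemma = solve-∀

alt-suc-diagonal : ∀ {c} → 1 ≤ c → ∀ y →
  alt c (suc c) 0 (y -ₙ c) ≡ ρ c (y -ₙ c) ℤ.+ ρ c y ℤ.- + δ y
alt-suc-diagonal {c} 1≤c y = begin
  alt c (suc c) 0 z
    ≡⟨ alt-unfold (s≤s z≤n) 0 z ⟩
  + δ z ℤ.- alt c (suc c) 1 u
    ≡⟨ cong (λ x → + δ z ℤ.- x) (alt-split c (s≤s z≤n) 0 u) ⟩
  + δ z ℤ.- (alt (suc c) (suc c) 0 u ℤ.+ alt (suc c) (suc c) 0 (u -ₙ c))
    ≡⟨ cong₂ (λ x x' → + δ z ℤ.- (x ℤ.+ x')) (alt-unfold (s≤s z≤n) 0 u) (alt-unfold (s≤s z≤n) 0 (u -ₙ c)) ⟩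
  + δ z ℤ.- ((+ δ u ℤ.- ρ (suc c) (u -ₙ suc c)) ℤ.+ (+ δ (u -ₙ c) ℤ.- ρ (suc c) (u -ₙ c -ₙ suc c)))
    ≡⟨ regroup (+ δ z) (+ δ u) (+ δ (u -ₙ c)) (+ δ y) (ρ (suc c) (u -ₙ suc c)) (ρ (suc c) (u -ₙ c -ₙ suc c)) ⟩
  (+ δ z ℤ.- + δ (u -ₙ c) ℤ.+ ρ (suc c) (u -ₙ c -ₙ suc c)) ℤ.+ (+ δ y ℤ.- + δ u ℤ.+ ρ (suc c) (u -ₙ suc c)) ℤ.- + δ y
    ≡⟨ cong₂ (λ r r' → r ℤ.+ r' ℤ.- + δ y) (sym (ρ-step′ z (suc c) c refl)) (sym (ρ-step′ y c (suc c) (+-suc c c))) ⟩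
  ρ c z ℤ.+ ρ c y ℤ.- + δ y ∎
  where
  open ≡-Reasoning
  z = y -ₙ c
  u = z -ₙ suc c
  ρ-step′ : ∀ x a b → a + b ≡ suc (c + c) →
    ρ c x ≡ + δ x ℤ.- + δ (x -ₙ a -ₙ b) ℤ.+ ρ (suc c) (x -ₙ a -ₙ b -ₙ suc c)
  ρ-step′ x a b a+b≡ = trans (ρ-step 1≤c x) (cong₂ (λ v v' → + δ x ℤ.- + δ v ℤ.+ ρ (suc c) v')
    (sym (-ₙ-merge x a b (trans a+b≡ (offset₁ c))))
    (sym (trans (cong (_-ₙ suc c) (-ₙ-merge x a b a+b≡)) (-ₙ-merge x (suc (c + c)) (suc c) (offset₂ c)))))
    where
    offset₁ : ∀ c → suc (c + c) ≡ 1 + 2 * c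
    offset₁ = solve-∀ℕ
    offset₂ : ∀ c → suc (c + c) + suc c ≡ 2 + 3 * c
    offset₂ = solve-∀ℕ
  regroup : ∀ (a b e f p q : ℤ) →
    a ℤ.- ((b ℤ.- p) ℤ.+ (e ℤ.- q)) ≡ (a ℤ.- e ℤ.+ q) ℤ.+ (f ℤ.- b ℤ.+ p) ℤ.- f
  regroup = solve-∀

-- The values of ρ

base : Sign → ℕ → ℕ
base Sign.+ c = 0
base Sign.- c = 1 + 2 * c

point : Sign → ℕ → ℕ → ℕ
point s c zero    = base s c
point s c (suc m) = stride c + point s (suc c) m

Special : ℕ → ℕ → Set
Special c w = Σ Sign λ s → Σ ℕ λ m → w ≡ point s c m

ρ-shift : ∀ {c} → 1 ≤ c → ∀ w → ρ c (+ (stride c + w)) ≡ ρ (suc c) (+ w)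
ρ-shift {c} 1≤c w = begin
  ρ c x
    ≡⟨ ρ-step 1≤c x ⟩
  + δ x ℤ.- + δ (x -ₙ (1 + 2 * c)) ℤ.+ ρ (suc c) (x -ₙ stride c)
    ≡⟨ cong₂ (λ v v' → + δ x ℤ.- + δ v ℤ.+ ρ (suc c) v')
         (trans (cong (λ v → + v -ₙ (1 + 2 * c)) (stride-split c w)) (m+n-ₙm≡n (1 + 2 * c) (suc (c + w))))
         (m+n-ₙm≡n (stride c) w) ⟩
  0ℤ ℤ.+ ρ (suc c) (+ w)
    ≡⟨ ℤₚ.+-identityˡ _ ⟩
  ρ (suc c) (+ w) ∎
  where
  open ≡-Reasoning
  x = + (stride c + w)
  stride-split : ∀ c w → 2 + 3 * c + w ≡ 1 + 2 * c + suc (c + w)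
  stride-split = solve-∀ℕ

ρ-point : ∀ {c} → 1 ≤ c → ∀ s m → ρ c (+ point s c m) ≡ s ◃ 1
ρ-point {c} 1≤c Sign.+ zero rewrite ρ-step 1≤c (+ 0) = refl
ρ-point {c} 1≤c Sign.- zero with -ₙ-view (1 + 2 * c) (stride c)
... | inj₁ (k , eq) = ⊥-elim (m≢1+m+n (1 + 2 * c) (trans eq (offset c k)))
  where
  offset : ∀ c k → 2 + 3 * c + k ≡ suc (1 + 2 * c + (c + k))
  offset = solve-∀ℕ
... | inj₂ (k , eq) rewrite ρ-step 1≤c (+ (1 + 2 * c)) | δ-self (1 + 2 * c) | eq = refl
ρ-point {c} 1≤c s (suc m) = trans (ρ-shift 1≤c (point s (suc c) m)) (ρ-point (s≤s z≤n) s m)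

ρ-support : ∀ {c} → 1 ≤ c → ∀ w → ρ c (+ w) ≢ 0ℤ → Special c w
ρ-support 1≤c w = bounded w 1≤c w ≤-refl
  where
  bounded : ∀ b {c} → 1 ≤ c → ∀ w → w ≤ b → ρ c (+ w) ≢ 0ℤ → Special c w
  bounded b {c} 1≤c w w≤b ρ≢0 with w ≟ 0 | w ≟ 1 + 2 * c | -ₙ-view w (stride c)
  ... | yes refl | _        | _ = Sign.+ , 0 , refl
  ... | no _     | yes refl | _ = Sign.- , 0 , refl
  ... | no w≢0   | no w≢1+2c | inj₂ (k , eq) = ⊥-elim (ρ≢0 vanishes)
    where
    vanishes : ρ c (+ w) ≡ 0ℤ
    vanishes rewrite ρ-step 1≤c (+ w) | δ-nonzero w≢0 | δ-≢ w≢1+2c | eq = refl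
  ... | no _ | no _ | inj₁ (w' , refl) with b
  ...   | zero with () ← n≤0⇒n≡0 w≤b
  ...   | suc b' with bounded b' (s≤s z≤n) w' (≤-pred (≤-trans (+-monoˡ-≤ w' (s≤s z≤n)) w≤b))
                                  (λ eq → ρ≢0 (trans (ρ-shift 1≤c w') eq))
  ...     | s , m , refl = s , suc m , refl

ρ-vanishes : ∀ {c} → 1 ≤ c → ∀ z → (∀ s m → z ≢ + point s c m) → ρ c z ≡ 0ℤ
ρ-vanishes _ -[1+ _ ] _ = refl
ρ-vanishes {c} 1≤c (+ w) nonspecial with ρ c (+ w) ℤ.≟ 0ℤ
... | yes ρ≡0 = ρ≡0
... | no ρ≢0 with ρ-support 1≤c w ρ≢0
...   | s , m , w≡point = ⊥-elim (nonspecial s m (cong +_ w≡point))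

base≤ : ∀ s c → base s c ≤ 1 + 2 * c
base≤ Sign.+ c = z≤n
base≤ Sign.- c = ≤-refl

stride≤point : ∀ s c m → stride c ≤ point s c (suc m)
stride≤point s c m = m≤m+n (stride c) (point s (suc c) m)

1+2c<stride : ∀ c → 1 + 2 * c < stride c
1+2c<stride c = s≤s (s≤s (*-monoˡ-≤ c {2} {3} (s≤s (s≤s z≤n))))

point-gap : ∀ {c} → 2 ≤ c → ∀ s m s' m' → point s' c m' ≢ 2 + point s c m
point-gap _ Sign.+ zero Sign.+ zero ()
point-gap _ Sign.- zero Sign.+ zero ()
point-gap (s≤s (s≤s _)) Sign.+ zero Sign.- zero ()
point-gap {c} _ Sign.- zero Sign.- zero eq = m≢1+m+n (1 + 2 * c) (trans eq (cong suc (+-comm 1 _)))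
point-gap {c} 2≤c s zero s' (suc m') eq = <-irrefl refl (begin
  suc (3 + 2 * c)  ≤⟨ gap ⟩
  stride c         ≤⟨ stride≤point s' c m' ⟩
  point s' c (suc m') ≡⟨ eq ⟩
  2 + base s c     ≤⟨ +-monoʳ-≤ 2 (base≤ s c) ⟩
  3 + 2 * c        ∎)
  where
  open ≤-Reasoning
  gap : 4 + 2 * c ≤ 2 + 3 * c
  gap = subst₂ _≤_ (e₁ c) (e₂ c) (+-monoʳ-≤ (2 + 2 * c) 2≤c)
    where
    e₁ : ∀ c → 2 + 2 * c + 2 ≡ 4 + 2 * c
    e₁ = solve-∀ℕ
    e₂ : ∀ c → 2 + 2 * c + c ≡ 2 + 3 * c
    e₂ = solve-∀ℕ
point-gap {c} _ s (suc m) s' zero eq = <-irrefl refl (begin-strict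
  base s' c           ≤⟨ base≤ s' c ⟩
  1 + 2 * c           <⟨ 1+2c<stride c ⟩
  stride c            ≤⟨ stride≤point s c m ⟩
  point s c (suc m)   ≤⟨ m≤n+m _ 2 ⟩
  2 + point s c (suc m) ≡⟨ sym eq ⟩
  base s' c ∎)
  where open ≤-Reasoning
point-gap {c} 2≤c s (suc m) s' (suc m') eq =
  point-gap (m≤n⇒m≤1+n 2≤c) s m s' m'
    (+-cancelˡ-≡ (stride c) _ _ (trans eq (+-comm-middle 2 (stride c) _)))
  where
  +-comm-middle : ∀ a b x → a + (b + x) ≡ b + (a + x)
  +-comm-middle = solve-∀ℕ

-- The four forms

point-closed : ∀ s c m → 2 * point s c m ≡ 3 * (m * m) + (6 * c + 1) * m + 2 * base s (c + m)
point-closed s c zero = trans (pad c (base s c))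
  (cong (λ x → 3 * (0 * 0) + (6 * c + 1) * 0 + 2 * base s x) (sym (+-identityʳ c)))
  where
  pad : ∀ c b → 2 * b ≡ 3 * (0 * 0) + (6 * c + 1) * 0 + 2 * b
  pad = solve-∀ℕ
point-closed s c (suc m) = begin
  2 * (stride c + point s (suc c) m)
    ≡⟨ *-distribˡ-+ 2 (stride c) (point s (suc c) m) ⟩
  2 * stride c + 2 * point s (suc c) m
    ≡⟨ cong (_+_ (2 * stride c)) (point-closed s (suc c) m) ⟩
  2 * stride c + (3 * (m * m) + (6 * suc c + 1) * m + 2 * base s (suc c + m))
    ≡⟨ cong (λ x → 2 * stride c + (3 * (m * m) + (6 * suc c + 1) * m + 2 * base s x)) (sym (+-suc c m)) ⟩
  2 * stride c + (3 * (m * m) + (6 * suc c + 1) * m + 2 * base s (c + suc m))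
    ≡⟨ expand c m (base s (c + suc m)) ⟩
  3 * (suc m * suc m) + (6 * c + 1) * suc m + 2 * base s (c + suc m) ∎
  where
  open ≡-Reasoning
  expand : ∀ c m b → 2 * (2 + 3 * c) + (3 * (m * m) + (6 * suc c + 1) * m + 2 * b)
                   ≡ 3 * (suc m * suc m) + (6 * c + 1) * suc m + 2 * b
  expand = solve-∀ℕ

double-shifted-point : ∀ a s m → 2 * (a + point s 2 m) ≡ 2 * a + (3 * (m * m) + 13 * m + 2 * base s (2 + m))
double-shifted-point a s m = trans (*-distribˡ-+ 2 a (point s 2 m)) (cong (_+_ (2 * a)) (point-closed s 2 m))

FormA⇔ : ∀ n → FormA n ⇔ (Σ ℕ λ m → n ≡ 9 + point Sign.+ 2 m)
FormA⇔ n = mk⇔ to from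
  where
  identity : ∀ m → 2 * (9 + point Sign.+ 2 m) ≡ 3 * ((2 + m) * (2 + m)) + (2 + m) + 4
  identity m = trans (double-shifted-point 9 Sign.+ m) (solve m)
    where
    solve : ∀ m → 18 + (3 * (m * m) + 13 * m + 2 * 0) ≡ 3 * ((2 + m) * (2 + m)) + (2 + m) + 4
    solve = solve-∀ℕ
  to : FormA n → Σ ℕ λ m → n ≡ 9 + point Sign.+ 2 m
  to (1 , s≤s () , _)
  to (suc (suc m) , _ , eq) = m , *-cancelˡ-≡ n _ 2 (trans eq (sym (identity m)))
  from : (Σ ℕ λ m → n ≡ 9 + point Sign.+ 2 m) → FormA n
  from (m , refl) = 2 + m , s≤s (s≤s z≤n) , identity m

FormC⇔ : ∀ n → FormC n ⇔ (Σ ℕ λ m → n ≡ 9 + point Sign.- 2 m)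
FormC⇔ n = mk⇔ to from
  where
  identity : ∀ m → 2 * (9 + point Sign.- 2 m) + (2 + m) ≡ 3 * ((2 + m + 1) * (2 + m + 1)) + 3
  identity m = trans (cong (_+ (2 + m)) (double-shifted-point 9 Sign.- m)) (solve m)
    where
    solve : ∀ m → 18 + (3 * (m * m) + 13 * m + 2 * (1 + 2 * (2 + m))) + (2 + m)
                ≡ 3 * ((2 + m + 1) * (2 + m + 1)) + 3
    solve = solve-∀ℕ
  to : FormC n → Σ ℕ λ m → n ≡ 9 + point Sign.- 2 m
  to (1 , s≤s () , _)
  to (suc (suc m) , _ , eq) =
    m , *-cancelˡ-≡ n _ 2 (+-cancelʳ-≡ (2 + m) _ _ (trans eq (sym (identity m))))
  from : (Σ ℕ λ m → n ≡ 9 + point Sign.- 2 m) → FormC n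
  from (m , refl) = 2 + m , s≤s (s≤s z≤n) , identity m

FormD⇔ : ∀ n → FormD n ⇔ (Σ ℕ λ m → n ≡ 7 + point Sign.+ 2 (suc m))
FormD⇔ n = mk⇔ to from
  where
  identity : ∀ m → 2 * (7 + point Sign.+ 2 (suc m)) ≡ 3 * ((2 + m + 1) * (2 + m + 1)) + (2 + m) + 1
  identity m = trans (double-shifted-point 7 Sign.+ (suc m)) (solve m)
    where
    solve : ∀ m → 14 + (3 * (suc m * suc m) + 13 * suc m + 2 * 0) ≡ 3 * ((2 + m + 1) * (2 + m + 1)) + (2 + m) + 1
    solve = solve-∀ℕ
  to : FormD n → Σ ℕ λ m → n ≡ 7 + point Sign.+ 2 (suc m)
  to (1 , s≤s () , _)
  to (suc (suc m) , _ , eq) = m , *-cancelˡ-≡ n _ 2 (trans eq (sym (identity m)))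
  from : (Σ ℕ λ m → n ≡ 7 + point Sign.+ 2 (suc m)) → FormD n
  from (m , refl) = 2 + m , s≤s (s≤s z≤n) , identity m

FormB⇔ : ∀ n → FormB n ⇔ (Σ ℕ λ m → n ≡ 7 + point Sign.- 2 m)
FormB⇔ n = mk⇔ to from
  where
  identity : ∀ m → 2 * (7 + point Sign.- 2 m) + (2 + m) + 1 ≡ 3 * ((2 + m + 1) * (2 + m + 1))
  identity m = trans (cong (λ x → x + (2 + m) + 1) (double-shifted-point 7 Sign.- m)) (solve m)
    where
    solve : ∀ m → 14 + (3 * (m * m) + 13 * m + 2 * (1 + 2 * (2 + m))) + (2 + m) + 1
                ≡ 3 * ((2 + m + 1) * (2 + m + 1))
    solve = solve-∀ℕ
  to : FormB n → Σ ℕ λ m → n ≡ 7 + point Sign.- 2 m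
  to (1 , s≤s () , _)
  to (suc (suc m) , _ , eq) =
    m , *-cancelˡ-≡ n _ 2 (+-cancelʳ-≡ (2 + m) _ _ (+-cancelʳ-≡ 1 _ _ (trans eq (sym (identity m)))))
  from : (Σ ℕ λ m → n ≡ 7 + point Sign.- 2 m) → FormB n
  from (m , refl) = 2 + m , s≤s (s≤s z≤n) , identity m

Δ : ℕ → ℤ
Δ n = ρ 2 (+ n -ₙ 9) ℤ.+ ρ 2 (+ n -ₙ 7) ℤ.- + δ (+ n -ₙ 7)

ρ-after-point : ∀ {c} → 2 ≤ c → ∀ s m → ρ c (+ (2 + point s c m)) ≡ 0ℤ
ρ-after-point 2≤c s m = ρ-vanishes (≤-trans (s≤s z≤n) 2≤c) _ λ s' m' eq →
  point-gap 2≤c s m s' m' (sym (ℤₚ.+-injective eq))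

Δ-by-terms : ∀ n {r₉ r₇ d₇} → ρ 2 (+ n -ₙ 9) ≡ r₉ → ρ 2 (+ n -ₙ 7) ≡ r₇ → δ (+ n -ₙ 7) ≡ d₇ →
  Δ n ≡ r₉ ℤ.+ r₇ ℤ.- + d₇
Δ-by-terms n refl refl refl = refl

Δ-at-9+point : ∀ {n} s m → n ≡ 9 + point s 2 m → Δ n ≡ s ◃ 1
Δ-at-9+point {n} s m refl = trans
  (Δ-by-terms n (trans (cong (ρ 2) (m+n-ₙm≡n 9 p)) (ρ-point (s≤s z≤n) s m))
            (trans (cong (ρ 2) (m+n-ₙm≡n 7 (2 + p))) (ρ-after-point ≤-refl s m))
            (cong δ (m+n-ₙm≡n 7 (2 + p))))
  (trans (ℤₚ.+-identityʳ _) (ℤₚ.+-identityʳ _))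
  where p = point s 2 m

Δ-at-7+point : ∀ {n} s m → n ≡ 7 + point s 2 m → point s 2 m ≢ 0 → Δ n ≡ s ◃ 1
Δ-at-7+point {n} s m refl p≢0 = trans
  (Δ-by-terms n (ρ-vanishes (s≤s z≤n) (+ n -ₙ 9) λ s' m' eq →
               point-gap ≤-refl s' m' s m (+-cancelˡ-≡ 7 _ _ (n-ₙa≡w⇒n≡a+w eq)))
            (trans (cong (ρ 2) (m+n-ₙm≡n 7 p)) (ρ-point (s≤s z≤n) s m))
            (trans (cong δ (m+n-ₙm≡n 7 p)) (δ-nonzero p≢0)))
  (trans (ℤₚ.+-identityʳ _) (ℤₚ.+-identityˡ _))
  where p = point s 2 m

AnyForm : ℕ → Set
AnyForm n = FormA n ⊎ FormB n ⊎ FormC n ⊎ FormD n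

Δ-elsewhere : ∀ n → ¬ AnyForm n → Δ n ≡ 0ℤ
Δ-elsewhere n none with n ≟ 7
... | yes refl = refl  -- ρ₂(0) = 1 cancels against δ(0)
... | no n≢7 = Δ-by-terms n
  (ρ-vanishes (s≤s z≤n) (+ n -ₙ 9) λ s m eq → none (at-9 s m (n-ₙa≡w⇒n≡a+w eq)))
  (ρ-vanishes (s≤s z≤n) (+ n -ₙ 7) λ s m eq → at-7 s m (n-ₙa≡w⇒n≡a+w eq))
  (δ-≢ n≢7)
  where
  at-9 : ∀ s m → n ≡ 9 + point s 2 m → AnyForm n
  at-9 Sign.+ m eq = inj₁ (Equivalence.from (FormA⇔ n) (m , eq))
  at-9 Sign.- m eq = inj₂ (inj₂ (inj₁ (Equivalence.from (FormC⇔ n) (m , eq))))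
  at-7 : ∀ s m → n ≢ 7 + point s 2 m
  at-7 Sign.+ zero    eq = n≢7 eq
  at-7 Sign.+ (suc m) eq = none (inj₂ (inj₂ (inj₂ (Equivalence.from (FormD⇔ n) (m , eq)))))
  at-7 Sign.- m       eq = none (inj₂ (inj₁ (Equivalence.from (FormB⇔ n) (m , eq))))

point⁻≢0 : ∀ c m → point Sign.- c m ≢ 0
point⁻≢0 c zero    ()
point⁻≢0 c (suc m) ()

Δ-at-FormA⊎D : ∀ n → FormA n ⊎ FormD n → Δ n ≡ + 1
Δ-at-FormA⊎D n (inj₁ a) = let m , eq = Equivalence.to (FormA⇔ n) a in Δ-at-9+point Sign.+ m eq
Δ-at-FormA⊎D n (inj₂ d) = let m , eq = Equivalence.to (FormD⇔ n) d in Δ-at-7+point Sign.+ (suc m) eq λ ()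

Δ-at-FormB⊎C : ∀ n → FormB n ⊎ FormC n → Δ n ≡ -[1+ 0 ]
Δ-at-FormB⊎C n (inj₁ b) = let m , eq = Equivalence.to (FormB⇔ n) b in Δ-at-7+point Sign.- m eq (point⁻≢0 2 m)
Δ-at-FormB⊎C n (inj₂ c) = let m , eq = Equivalence.to (FormC⇔ n) c in Δ-at-9+point Sign.- m eq

-- Enumerating the partitions

subsets : ℕ → ℕ → ℤ → List (List ℕ)
subsets c zero    (+ zero) = [] ∷ []
subsets c zero    _        = []
subsets c (suc L) z = subsets c L z ++ map (_∷_ (c + L)) (subsets c L (z -ₙ (c + L)))

length-subsets : ∀ c L z → length (subsets c L z) ≡ subsetCount c L z
length-subsets c zero    (+ zero)   = refl
length-subsets c zero    (+ suc _)  = refl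
length-subsets c zero    -[1+ _ ]   = refl
length-subsets c (suc L) z = begin
  length (subsets c L z ++ map (_∷_ (c + L)) (subsets c L z'))
    ≡⟨ length-++ (subsets c L z) ⟩
  length (subsets c L z) + length (map (_∷_ (c + L)) (subsets c L z'))
    ≡⟨ cong (_+_ (length (subsets c L z))) (length-map (_∷_ (c + L)) (subsets c L z')) ⟩
  length (subsets c L z) + length (subsets c L z')
    ≡⟨ cong₂ _+_ (length-subsets c L z) (length-subsets c L z') ⟩
  subsetCount c L z + subsetCount c L z' ∎
  where
  open ≡-Reasoning
  z' = z -ₙ (c + L)

SubsetSum : ℕ → ℕ → ℤ → List ℕ → Set
SubsetSum c L z xs = Linked _>_ xs × All (λ x → c ≤ x × x < c + L) xs × + sum xs ≡ z

Linked->-∷ : ∀ {x ys} → All (_< x) ys → Linked _>_ ys → Linked _>_ (x ∷ ys)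
Linked->-∷ []      []  = [-]
Linked->-∷ (y<x ∷ _) ys> = y<x ∷ ys>

Linked-head-All : ∀ {R : ℕ → ℕ → Set} → Transitive R → ∀ {x xs} → Linked R (x ∷ xs) → All (R x) xs
Linked-head-All trans [-]        = []
Linked-head-All trans (Rxy ∷ Ry) = Linked⇒All trans Rxy Ry

Linked->-head : ∀ {x ys} → Linked _>_ (x ∷ ys) → All (_< x) ys
Linked->-head = Linked-head-All (λ p q → <-trans q p)

widen : ∀ c L {x} → c ≤ x × x < c + L → c ≤ x × x < c + suc L
widen c L (c≤x , x<c+L) = c≤x , <-trans x<c+L (+-monoʳ-< c (n<1+n L))

∈-subsets⁻ : ∀ c L z {xs} → xs ∈ subsets c L z → SubsetSum c L z xs
∈-subsets⁻ c zero (+ zero) (here refl) = [] , [] , refl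
∈-subsets⁻ c (suc L) z xs∈ with ∈-++⁻ (subsets c L z) xs∈
... | inj₁ xs∈ˡ = let xs> , bounds , xsum = ∈-subsets⁻ c L z xs∈ˡ in
  xs> , All.map (widen c L) bounds , xsum
... | inj₂ xs∈ʳ with ∈-map⁻ (_∷_ (c + L)) xs∈ʳ
...   | ys , ys∈ , refl = let ys> , bounds , ysum = ∈-subsets⁻ c L (z -ₙ (c + L)) ys∈ in
  Linked->-∷ (All.map proj₂ bounds) ys>
  , (m≤m+n c L , +-monoʳ-< c (n<1+n L)) ∷ All.map (widen c L) bounds
  , s≡z-ₙx⇒x+s≡z (c + L) (sum ys) z ysum

∈-subsets⁺ : ∀ c L z {xs} → SubsetSum c L z xs → xs ∈ subsets c L z
∈-subsets⁺ c zero z {[]} (_ , _ , refl) = here refl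
∈-subsets⁺ c zero z {x ∷ _} (_ , (c≤x , x<c+0) ∷ _ , _) =
  ⊥-elim (<⇒≱ (subst (x <_) (+-identityʳ c) x<c+0) c≤x)
∈-subsets⁺ c (suc L) z {[]} (_ , _ , sum≡) = ∈-++⁺ˡ (∈-subsets⁺ c L z ([] , [] , sum≡))
∈-subsets⁺ c (suc L) z {x ∷ ys} (xs> , (c≤x , x<c+1+L) ∷ bounds , sum≡) with x ≟ c + L
... | yes refl = ∈-++⁺ʳ (subsets c L z) (∈-map⁺ (_∷_ (c + L)) (∈-subsets⁺ c L _
  (Linked.tail xs> , All.zipWith (λ ((c≤y , _) , y<x) → c≤y , y<x) (bounds , Linked->-head xs>)
  , x+s≡z⇒s≡z-ₙx (c + L) (sum ys) z sum≡)))
... | no x≢c+L = ∈-++⁺ˡ (∈-subsets⁺ c L z (xs> , (c≤x , x<c+L) ∷ bounds' , sum≡))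
  where
  x<c+L : x < c + L
  x<c+L = ≤∧≢⇒< (≤-pred (subst (x <_) (+-suc c L) x<c+1+L)) x≢c+L
  bounds' : All (λ y → c ≤ y × y < c + L) ys
  bounds' = All.zipWith (λ ((c≤y , _) , y<x) → c≤y , <-trans y<x x<c+L) (bounds , Linked->-head xs>)

subsets-unique : ∀ c L z → Unique (subsets c L z)
subsets-unique c zero    (+ zero)  = [] ∷ []
subsets-unique c zero    (+ suc _) = []
subsets-unique c zero    -[1+ _ ]  = []
subsets-unique c (suc L) z =
  Unique.++⁺ (subsets-unique c L z) (Unique.map⁺ ∷-injectiveʳ (subsets-unique c L _)) disjoint
  where
  disjoint : ∀ {xs} → ¬ (xs ∈ subsets c L z × xs ∈ map (_∷_ (c + L)) (subsets c L (z -ₙ (c + L))))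
  disjoint (xs∈ˡ , xs∈ʳ) with ∈-map⁻ (_∷_ (c + L)) xs∈ʳ
  ... | _ , _ , refl with ∈-subsets⁻ c L z xs∈ˡ
  ...   | _ , (_ , c+L<c+L) ∷ _ , _ = <-irrefl refl c+L<c+L

triple : ℕ → List ℕ → List ℕ
triple a S = a ∷ a ∷ a ∷ S

triple-injectiveʳ : ∀ {a S S'} → triple a S ≡ triple a S' → S ≡ S'
triple-injectiveʳ refl = refl

layer : ℕ → ℤ → List (List ℕ)
layer i z = map (triple (3 + i)) (subsets 2 i (z -ₙ 3 * i))

∈-layer⁻ : ∀ i z {ps} → ps ∈ layer i z → Σ (List ℕ) λ S → ps ≡ triple (3 + i) S
∈-layer⁻ i z ps∈ = let S , _ , eq = ∈-map⁻ (triple (3 + i)) ps∈ in S , eq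

isEven : ℕ → Bool
isEven zero    = true
isEven (suc n) = not (isEven n)

-- byParity k i z b lists the layers i + j with j < k and isEven j ≡ b.
byParity : ℕ → ℕ → ℤ → Bool → List (List ℕ)
byParity zero    i z _     = []
byParity (suc k) i z true  = layer i z ++ byParity k (suc i) z false
byParity (suc k) i z false = byParity k (suc i) z true

length-byParity : ∀ k i z →
  + length (byParity k i z true) ℤ.- + length (byParity k i z false) ≡ altSum k 2 3 i (z -ₙ 3 * i)
length-byParity zero    i z = refl
length-byParity (suc k) i z = begin
  + length (layer i z ++ B) ℤ.- + length A
    ≡⟨ cong (λ x → + x ℤ.- + length A) (length-++ (layer i z)) ⟩
  + (length (layer i z) + length B) ℤ.- + length A
    ≡⟨ cong (λ x → + (x + length B) ℤ.- + length A) (trans (length-map _ (subsets 2 i _)) (length-subsets 2 i _)) ⟩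
  + (T + length B) ℤ.- + length A
    ≡⟨ regroup T (length B) (length A) ⟩
  + T ℤ.- (+ length A ℤ.- + length B)
    ≡⟨ cong (λ x → + T ℤ.- x) (length-byParity k (suc i) z) ⟩
  + T ℤ.- altSum k 2 3 (suc i) (z -ₙ 3 * suc i)
    ≡⟨ cong (λ x → + T ℤ.- altSum k 2 3 (suc i) x) (sym (-ₙ-merge z (3 * i) 3 (trans (+-comm (3 * i) 3) (sym (*-suc 3 i))))) ⟩
  + T ℤ.- altSum k 2 3 (suc i) (z -ₙ 3 * i -ₙ 3) ∎
  where
  open ≡-Reasoning
  A = byParity k (suc i) z true
  B = byParity k (suc i) z false
  T = subsetCount 2 i (z -ₙ 3 * i)
  regroup : ∀ t b a → + (t + b) ℤ.- + a ≡ + t ℤ.- (+ a ℤ.- + b)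
  regroup t b a rewrite ℤₚ.pos-+ t b = lemma (+ t) (+ b) (+ a)
    where
    lemma : ∀ (t b a : ℤ) → t ℤ.+ b ℤ.- a ≡ t ℤ.- (a ℤ.- b)
    lemma = solve-∀

∈-layer-cong : ∀ {i i'} z {ps} → i ≡ i' → ps ∈ layer i z → ps ∈ layer i' z
∈-layer-cong z {ps} = subst (λ x → ps ∈ layer x z)

∈-byParity⁻ : ∀ k i z b {ps} → ps ∈ byParity k i z b → Σ ℕ λ j → isEven j ≡ b × ps ∈ layer (i + j) z
∈-byParity⁻ (suc k) i z true ps∈ with ∈-++⁻ (layer i z) ps∈
... | inj₁ ps∈layer = 0 , refl , ∈-layer-cong z (sym (+-identityʳ i)) ps∈layer
... | inj₂ ps∈rest  = let j , e , ps∈' = ∈-byParity⁻ k (suc i) z false ps∈rest in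
  suc j , cong not e , ∈-layer-cong z (sym (+-suc i j)) ps∈'
∈-byParity⁻ (suc k) i z false ps∈ = let j , e , ps∈' = ∈-byParity⁻ k (suc i) z true ps∈ in
  suc j , cong not e , ∈-layer-cong z (sym (+-suc i j)) ps∈'

∈-byParity⁺ : ∀ k i z j → j < k → ∀ {ps} → ps ∈ layer (i + j) z → ps ∈ byParity k i z (isEven j)
∈-byParity⁺ (suc k) i z zero _ ps∈ = ∈-++⁺ˡ (∈-layer-cong z (+-identityʳ i) ps∈)
∈-byParity⁺ (suc k) i z (suc j) (s≤s j<k) ps∈
  with isEven j | ∈-byParity⁺ k (suc i) z j j<k (∈-layer-cong z (+-suc i j) ps∈)
... | true  | ps∈rest = ps∈rest
... | false | ps∈rest = ∈-++⁺ʳ (layer i z) ps∈rest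

byParity-unique : ∀ k i z b → Unique (byParity k i z b)
byParity-unique zero    i z _     = []
byParity-unique (suc k) i z false = byParity-unique k (suc i) z true
byParity-unique (suc k) i z true  =
  Unique.++⁺ (Unique.map⁺ triple-injectiveʳ (subsets-unique 2 i _)) (byParity-unique k (suc i) z false) disjoint
  where
  disjoint : ∀ {ps} → ¬ (ps ∈ layer i z × ps ∈ byParity k (suc i) z false)
  disjoint (ps∈layer , ps∈rest) with ∈-layer⁻ i z ps∈layer | ∈-byParity⁻ k (suc i) z false ps∈rest
  ... | S , refl | j , _ , ps∈' = m≢1+m+n (3 + i) (∷-injectiveˡ (proj₂ (∈-layer⁻ (suc i + j) z ps∈')))

∈-layer⇔ : ∀ i z ps →
  ps ∈ layer i z ⇔ (Σ (List ℕ) λ S → ps ≡ triple (3 + i) S × SubsetSum 2 i (z -ₙ 3 * i) S)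
∈-layer⇔ i z ps = mk⇔
  (λ ps∈ → let S , S∈ , eq = ∈-map⁻ (triple (3 + i)) ps∈ in S , eq , ∈-subsets⁻ 2 i _ S∈)
  (λ { (S , refl , S-sum) → ∈-map⁺ (triple (3 + i)) (∈-subsets⁺ 2 i _ S-sum) })

3+-parity : ∀ i → (isEven i ≡ false × Σ ℕ λ q → 3 + i ≡ q * 2) ⊎ (isEven i ≡ true × Σ ℕ λ q → 3 + i ≡ 1 + q * 2)
3+-parity zero = inj₂ (refl , 1 , refl)
3+-parity (suc i) with 3+-parity i
... | inj₁ (e , q , eq) = inj₂ (cong not e , q , cong suc eq)
... | inj₂ (e , q , eq) = inj₁ (cong not e , suc q , cong suc eq)

odd-not-Even : ∀ q → ¬ Even (1 + q * 2)
odd-not-Even q 2∣ with () ← ∣1⇒≡1 (∣m+n∣m⇒∣n (subst (2 ∣_) (+-comm 1 (q * 2)) 2∣) (n∣m*n q))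

Even-3+⇔ : ∀ i → Even (3 + i) ⇔ isEven i ≡ false
Even-3+⇔ i with 3+-parity i
... | inj₁ (e , q , eq) = mk⇔ (λ _ → e) (λ _ → divides q eq)
... | inj₂ (e , q , eq) = mk⇔ (λ 2∣ → ⊥-elim (odd-not-Even q (subst Even eq 2∣))) (λ e' → ⊥-elim (not-¬ e e'))

ParityOf : Bool → ℕ → Set
ParityOf true  = Odd
ParityOf false = Even

ParityOf-3+⇔ : ∀ b i → ParityOf b (3 + i) ⇔ isEven i ≡ b
ParityOf-3+⇔ false i = Even-3+⇔ i
ParityOf-3+⇔ true  i = mk⇔
  (λ odd → ¬-not (λ e → odd (Equivalence.from (Even-3+⇔ i) e)))
  (λ e even → not-¬ e (Equivalence.to (Even-3+⇔ i) even))

≥2-from-last : ∀ {xs} → Linked _≥_ xs → All (1 ≤_) xs → last xs ≢ just 1 → All (2 ≤_) xs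
≥2-from-last {[]}         _ _ _ = []
≥2-from-last {y ∷ []}     _ (1≤y ∷ []) y≢1 = two 1≤y (λ y≡1 → y≢1 (cong just y≡1)) ∷ []
  where
  two : ∀ {y} → 1 ≤ y → y ≢ 1 → 2 ≤ y
  two {suc zero}    _ y≢1 = ⊥-elim (y≢1 refl)
  two {suc (suc _)} _ _   = s≤s (s≤s z≤n)
≥2-from-last {y ∷ z ∷ zs} (z≤y ∷ zs≥) (_ ∷ 1≤zs) last≢1 with ≥2-from-last zs≥ 1≤zs last≢1
... | 2≤zs@(2≤z ∷ _) = ≤-trans 2≤z z≤y ∷ 2≤zs

below-fourth : ∀ {i rest} → Linked _≥_ rest → FourthCond (3 + i) rest → All (_< 2 + i) rest
below-fourth {rest = []}     _    _ = []
below-fourth {i} {y ∷ ys} ys≥ y+2≤3+i =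
  y<2+i ∷ All.map (λ z≤y → ≤-<-trans z≤y y<2+i) (Linked-head-All (λ p q → ≤-trans q p) ys≥)
  where
  y<2+i : y < 2 + i
  y<2+i = ≤-pred (subst (_≤ 3 + i) (+-comm y 2) y+2≤3+i)

last-≢1 : ∀ {xs} → All (2 ≤_) xs → last xs ≢ just 1
last-≢1 {[]}          _                   ()
last-≢1 {_ ∷ []}      (s≤s () ∷ [])       refl
last-≢1 {y ∷ z ∷ zs}  (_ ∷ 2≤z∷zs)         = last-≢1 2≤z∷zs

fourth-from-bound : ∀ {i S} → All (λ x → 2 ≤ x × x < 2 + i) S → FourthCond (3 + i) S
fourth-from-bound []                     = tt
fourth-from-bound {i} {y ∷ _} ((_ , y<2+i) ∷ _) = subst (_≤ 3 + i) (+-comm 2 y) (s≤s y<2+i)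

triple-sum⇔ : ∀ i s n → (3 + i) + ((3 + i) + ((3 + i) + s)) ≡ n ⇔ + s ≡ + n -ₙ 9 -ₙ 3 * i
triple-sum⇔ i s n = mk⇔
  (λ eq → trans (x+s≡z⇒s≡z-ₙx (9 + 3 * i) s (+ n) (cong +_ (trans (reorder i s) eq))) (sym (-ₙ-+ (+ n) 9 (3 * i))))
  (λ eq → trans (sym (reorder i s)) (ℤₚ.+-injective (s≡z-ₙx⇒x+s≡z (9 + 3 * i) s (+ n) (trans eq (-ₙ-+ (+ n) 9 (3 * i))))))
  where
  reorder : ∀ i s → 9 + 3 * i + s ≡ (3 + i) + ((3 + i) + ((3 + i) + s))
  reorder = solve-∀ℕ

partition⇒layer : ∀ par n ps → IsPartition n ps × Shape par ps → Σ ℕ λ i → par (3 + i) × ps ∈ layer i (+ n -ₙ 9)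
partition⇒layer par n ps@(_ ∷ _ ∷ .(3 + i) ∷ rest)
  ((ps≥ , 1≤ps , sum≡) , (refl , refl , s≤s (s≤s (s≤s {n = i} _)) , par-p , distinct , fourth , last≢1)) =
  i , par-p , Equivalence.from (∈-layer⇔ i (+ n -ₙ 9) ps)
    (rest , refl , rest> , bounds , Equivalence.to (triple-sum⇔ i (sum rest) n) sum≡)
  where
  rest≥ : Linked _≥_ rest
  rest≥ = Linked.tail (Linked.tail (Linked.tail ps≥))
  rest> : Linked _>_ rest
  rest> = Linked.zipWith (λ (y≤x , x≢y) → ≤∧≢⇒< y≤x (λ y≡x → x≢y (sym y≡x))) (rest≥ , AllPairs⇒Linked distinct)
  bounds : All (λ x → 2 ≤ x × x < 2 + i) rest
  bounds = All.zip
    (All.tail (All.tail (All.tail (≥2-from-last ps≥ 1≤ps last≢1))) , below-fourth rest≥ fourth)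

layer⇒partition : ∀ par n i {ps} → par (3 + i) → ps ∈ layer i (+ n -ₙ 9) → IsPartition n ps × Shape par ps
layer⇒partition par n i {ps} par-3+i ps∈ with Equivalence.to (∈-layer⇔ i (+ n -ₙ 9) ps) ps∈
... | S , refl , S> , bounds , S-sum =
  (≤-refl ∷ ≤-refl ∷ Linked.map <⇒≤ (Linked->-∷ (All.map (λ (_ , x<2+i) → m<n⇒m<1+n x<2+i) bounds) S>)
  , All.map (≤-trans (s≤s z≤n)) 2≤ps
  , Equivalence.from (triple-sum⇔ i (sum S) n) S-sum)
  , (refl , refl , s≤s (s≤s (s≤s z≤n)) , par-3+i
  , AllPairs.map (λ y<x x≡y → <-irrefl (sym x≡y) y<x) (Linked⇒AllPairs (λ p q → <-trans q p) S>)
  , fourth-from-bound bounds , last-≢1 2≤ps)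
  where
  2≤ps : All (2 ≤_) (triple (3 + i) S)
  2≤ps = s≤s (s≤s z≤n) ∷ s≤s (s≤s z≤n) ∷ s≤s (s≤s z≤n) ∷ All.map proj₁ bounds

partitions : ℕ → Bool → List (List ℕ)
partitions n = byParity (suc n) 0 (+ n -ₙ 9)

∈-partitions⇔ : ∀ n b ps → ps ∈ partitions n b ⇔ (IsPartition n ps × Shape (ParityOf b) ps)
∈-partitions⇔ n b ps = mk⇔ to from
  where
  z = + n -ₙ 9
  to : ps ∈ partitions n b → IsPartition n ps × Shape (ParityOf b) ps
  to ps∈ = let j , e , ps∈layer = ∈-byParity⁻ (suc n) 0 z b ps∈ in
    layer⇒partition (ParityOf b) n j (Equivalence.from (ParityOf-3+⇔ b j) e) ps∈layer
  from : IsPartition n ps × Shape (ParityOf b) ps → ps ∈ partitions n b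
  from h@((_ , _ , sum≡) , _) with partition⇒layer (ParityOf b) n ps h
  ... | i , par , ps∈layer with ∈-layer⁻ i z ps∈layer
  ...   | S , refl = subst (λ b' → ps ∈ byParity (suc n) 0 z b') (Equivalence.to (ParityOf-3+⇔ b i) par)
                       (∈-byParity⁺ (suc n) 0 z i i<1+n ps∈layer)
    where
    i<1+n : i < suc n
    i<1+n = s≤s (≤-trans (m≤n+m i 3) (≤-trans (m≤m+n (3 + i) _) (≤-reflexive sum≡)))

count-difference : ∀ n → + length (partitions n true) ℤ.- + length (partitions n false) ≡ Δ n
count-difference n = begin
  + length (partitions n true) ℤ.- + length (partitions n false)
    ≡⟨ length-byParity (suc n) 0 z ⟩
  altSum (suc n) 2 3 0 (z -ₙ 0)
    ≡⟨ cong (altSum (suc n) 2 3 0) (ℤₚ.+-identityʳ z) ⟩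
  altSum (suc n) 2 3 0 z
    ≡⟨ altSum-fuel-irrelevant (s≤s z≤n) (suc n) (fuel z) 0 z (Exceeds-sub n 9) (Exceeds-fuel z) ⟩
  alt 2 3 0 z
    ≡⟨ cong (alt 2 3 0) (sym y-2≡z) ⟩
  alt 2 3 0 (y -ₙ 2)
    ≡⟨ alt-suc-diagonal (s≤s z≤n) y ⟩
  ρ 2 (y -ₙ 2) ℤ.+ ρ 2 y ℤ.- + δ y
    ≡⟨ cong (λ x → ρ 2 x ℤ.+ ρ 2 y ℤ.- + δ y) y-2≡z ⟩
  Δ n ∎
  where
  open ≡-Reasoning
  z = + n -ₙ 9
  y = + n -ₙ 7
  y-2≡z : y -ₙ 2 ≡ z
  y-2≡z = -ₙ-merge (+ n) 7 2 refl

e+Δ≡o : ∀ n → + length (partitions n false) ℤ.+ Δ n ≡ + length (partitions n true)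
e+Δ≡o n = trans (cong (ℤ._+_ (+ e)) (sym (count-difference n))) (cancel (+ e) (+ o))
  where
  e = length (partitions n false)
  o = length (partitions n true)
  cancel : ∀ (e o : ℤ) → e ℤ.+ (o ℤ.- e) ≡ o
  cancel = solve-∀

+m+0≡+n⇒m≡n : ∀ {e o} → + e ℤ.+ 0ℤ ≡ + o → e ≡ o
+m+0≡+n⇒m≡n {e} eq = trans (sym (+-identityʳ e)) (ℤₚ.+-injective eq)

+m+1≡+n⇒m+1≡n : ∀ {e o} → + e ℤ.+ + 1 ≡ + o → e + 1 ≡ o
+m+1≡+n⇒m+1≡n = ℤₚ.+-injective

+m-1≡+n⇒m≡n+1 : ∀ {e o} → + e ℤ.+ -[1+ 0 ] ≡ + o → e ≡ o + 1
+m-1≡+n⇒m≡n+1 {suc e} refl = +-comm 1 e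

-- The argument works for every n.
corollary4p8 : (n : ℕ) → 6 ≤ n →
    Σ ℕ λ e → Σ ℕ λ o →
    HasCount (EPart n) e × HasCount (OPart n) o
    × (¬ (FormA n ⊎ FormB n ⊎ FormC n ⊎ FormD n) → e ≡ o)
    × (FormA n ⊎ FormD n → e + 1 ≡ o)
    × (FormB n ⊎ FormC n → e ≡ o + 1)
corollary4p8 n _ = length (partitions n false) , length (partitions n true) , count false , count true
  , (λ none → +m+0≡+n⇒m≡n (e+Δ≡o-at (Δ-elsewhere n none)))
  , (λ A⊎D → +m+1≡+n⇒m+1≡n (e+Δ≡o-at (Δ-at-FormA⊎D n A⊎D)))
  , (λ B⊎C → +m-1≡+n⇒m≡n+1 (e+Δ≡o-at (Δ-at-FormB⊎C n B⊎C)))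
  where
  count : ∀ b → HasCount (λ ps → IsPartition n ps × Shape (ParityOf b) ps) (length (partitions n b))
  count b = partitions n b , byParity-unique (suc n) 0 _ b , ∈-partitions⇔ n b , refl
  e+Δ≡o-at : ∀ {d} → Δ n ≡ d → + length (partitions n false) ℤ.+ d ≡ + length (partitions n true)
  e+Δ≡o-at refl = e+Δ≡o n
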